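{- Let $n\ge 3$ and let $d\ge 0$ be an integer. The prism $C_n\times P_2$ admits an $(a,d)$-distance antimagic labeling for some integer $a$ if and only if $d=1$.
   Context: The prism $C_n\times P_2$ is the Cartesian product of the cycle $C_n$ and the path on two vertices; it is a 3-regular graph on $2n$ vertices. For a graph $G$ with $v$ vertices and a bijection $f:V(G)\to\{1,\ldots,v\}$, the vertex-weight of $x$ is $w(x)=\sum_{y\in N(x)} f(y)$, $N(x)$ the set of neighbors of $x$. $f$ is an $(a,d)$-distance antimagic labeling, for fixed integers $a$ and $d\ge 0$, if the multiset of vertex-weights is $\{a,a+d,\ldots,a+(v-1)d\}$. -}

module Defs where

open import Data.Nat using (ℕ; zero; suc; _+_; _*_; _%_; _≟_)
open import Data.Nat.Properties using ()
open import Data.Fin using (Fin; toℕ)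
open import Data.Fin.Properties using () renaming (_≟_ to _≟ᶠ_)
open import Data.Product using (_×_; _,_; Σ; ∃)
open import Data.Sum using (_⊎_)
open import Data.Nat.ListAction using (sum)
open import Data.List using (List; map; filter; allFin; cartesianProduct)
open import Data.Integer using (ℤ; +_) renaming (_+_ to _+ℤ_; _*_ to _*ℤ_)
open import Function.Bundles using (_⤖_; Bijection)
open import Relation.Nullary using (Dec; yes; no; ¬_)
open import Relation.Nullary.Decidable using (_⊎-dec_; _×-dec_; ¬?)
open import Relation.Binary.PropositionalEquality using (_≡_)

PrismV : ℕ → Set
PrismV n = Fin n × Fin 2

CycAdj : (n : ℕ) → Fin n → Fin n → Set
CycAdj zero i i' = Fin 0
CycAdj (suc m) i i' =
  (toℕ i' ≡ (suc (toℕ i)) % (suc m)) ⊎ (toℕ i ≡ (suc (toℕ i')) % (suc m))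

cycAdj? : (n : ℕ) → (i i' : Fin n) → Dec (CycAdj n i i')
cycAdj? zero () i'
cycAdj? (suc m) i i' =
  (toℕ i' ≟ (suc (toℕ i)) % (suc m)) ⊎-dec (toℕ i ≟ (suc (toℕ i')) % (suc m))

PrismAdj : (n : ℕ) → PrismV n → PrismV n → Set
PrismAdj n (i , j) (i' , j') = ((j ≡ j') × CycAdj n i i') ⊎ ((i ≡ i') × ¬ (j ≡ j'))

prismAdj? : (n : ℕ) → (x y : PrismV n) → Dec (PrismAdj n x y)
prismAdj? n (i , j) (i' , j') =
  ((j ≟ᶠ j') ×-dec cycAdj? n i i') ⊎-dec ((i ≟ᶠ i') ×-dec ¬? (j ≟ᶠ j'))

prismVertices : (n : ℕ) → List (PrismV n)
prismVertices n = cartesianProduct (allFin n) (allFin 2)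

-- Labeling: a bijection f from V onto {1,…,2n}, represented as a bijection
-- V ⤖ Fin (2n) with label f(x) = toℕ (f x) + 1.
label : {n : ℕ} → (PrismV n ⤖ Fin (2 * n)) → PrismV n → ℕ
label f x = suc (toℕ (Bijection.to f x))

weight : (n : ℕ) → (PrismV n ⤖ Fin (2 * n)) → PrismV n → ℕ
weight n f x = sum (map (label f) (filter (prismAdj? n x) (prismVertices n)))

-- (a,d)-distance antimagic labeling: the multiset of vertex weights equals
-- {a, a+d, …, a+(v-1)d}, i.e. there is a bijection g : V ⤖ Fin v with
-- w(x) = a + g(x)·d for every vertex x.
IsDistanceAntimagic : (n : ℕ) → (PrismV n ⤖ Fin (2 * n)) → ℤ → ℕ → Set
IsDistanceAntimagic n f a d =
  Σ (PrismV n ⤖ Fin (2 * n)) λ g →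
    ∀ x → + (weight n f x) ≡ a +ℤ (+ (toℕ (Bijection.to g x) * d))

-- Every vertex (i , j) of the prism has exactly the three neighbours (i - 1 , j), (i + 1 , j)
-- and (i , 1 - j), and each of these maps permutes the vertices, so the weights of any labeling
-- sum to three times the labels. With N = 2n vertices and weights a, a + d, …, a + (N - 1)d this
-- double count reads 3 + 3N + d = 2a + dN. Hence d is odd, and d ≥ 3 would force a ≤ 3, whereas
-- the smallest weight contains two distinct labels and so is at least 4. For d = 1 an explicit
-- labeling works: the bottom cycle is labelled 1, …, n in order and the top cycle in reverse
-- order, shifted by one.
module Submission where

open import Defs
open import Data.Empty using (⊥-elim)
open import Data.Fin using (Fin; zero; suc; toℕ; opposite)
open import Data.Fin.Permutation
  using (Permutation′; permutation; _⟨$⟩ʳ_; _∘ₚ_; flip; reverse; cast-id)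
  renaming (id to idₚ)
open import Data.Fin.Properties
  using (suc-injective; toℕ-injective; toℕ<n; toℕ≤pred[n]; toℕ-cast; toℕ-↑ˡ; toℕ-↑ʳ; toℕ-fromℕ<; opposite-prop; +↔⊎)
  renaming (_≟_ to _≟ᶠ_)
open import Data.Integer using (ℤ)
import Data.Integer as ℤ
import Data.Integer.Properties as ℤ
open import Data.List using (List; []; _∷_; map; filter; allFin; cartesianProduct; _++_)
open import Data.List.Properties using (map-++; map-∘; map-cong; map-tabulate)
open import Data.Nat using (ℕ; zero; suc; _+_; _*_; _≤_; _<_; s≤s; z≤n; NonZero; _%_)
open import Data.Nat.DivMod using (_mod_; %-distribˡ-+; m%n%n≡m%n; [m+n]%n≡m%n; m<n⇒m%n≡m; m≡m%n+[m/n]*n; _/_)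
open import Data.Nat.Divisibility using (divides; ∣⇒≤)
open import Data.Nat.ListAction using (sum)
open import Data.Nat.ListAction.Properties using (sum-++)
open import Data.Nat.Properties hiding (suc-injective)
open import Algebra.Properties.CommutativeSemigroup +-commutativeSemigroup using (interchange)
open import Data.Nat.Tactic.RingSolver using (solve)
open import Data.Product using (Σ; ∃; _×_; _,_; proj₁; proj₂)
open import Data.Product.Function.NonDependent.Propositional using (_×-↔_)
open import Data.Product.Properties using (≡-dec)
open import Data.Sum using (_⊎_; inj₁; inj₂; [_,_])
import Data.Sum as Sum
open import Data.Sum.Function.Propositional using (_⊎-↔_)
open import Function.Base using (_∘_; const)
open import Function.Bundles using (_⤖_; _⇔_; _↔_; Bijection; Inverse; Equivalence; mk↔ₛ′; mk⇔)
open import Function.Construct.Composition using (_↔-∘_)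
open import Function.Construct.Identity using (⇔-id)
open import Function.Construct.Symmetry using (↔-sym)
open import Function.Properties.Bijection using (⤖⇒↔)
open import Function.Properties.Inverse using (↔⇒⤖)
open import Relation.Binary.Definitions using (DecidableEquality)
open import Relation.Binary.PropositionalEquality using (_≡_; _≢_; refl; sym; trans; cong; cong₂; subst; module ≡-Reasoning)
open import Relation.Nullary using (Dec; yes; no; ¬_)
open import Relation.Nullary.Decidable using (_⊎-dec_)
open import Relation.Unary using (Decidable)

private variable
  A B : Set
  P Q R : Set

∑ : List A → (A → ℕ) → ℕ
∑ xs f = sum (map f xs)

∑-cong : ∀ (xs : List A) {f g : A → ℕ} → (∀ x → f x ≡ g x) → ∑ xs f ≡ ∑ xs g
∑-cong xs f≗g = cong sum (map-cong f≗g xs)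

∑-zero : ∀ (xs : List A) {f : A → ℕ} → (∀ x → f x ≡ 0) → ∑ xs f ≡ 0
∑-zero []       f≗0 = refl
∑-zero (x ∷ xs) f≗0 = cong₂ _+_ (f≗0 x) (∑-zero xs f≗0)

∑-+ : ∀ (xs : List A) (f g : A → ℕ) → ∑ xs (λ x → f x + g x) ≡ ∑ xs f + ∑ xs g
∑-+ []       f g = refl
∑-+ (x ∷ xs) f g = trans (cong (f x + g x +_) (∑-+ xs f g)) (interchange (f x) (g x) _ _)

∑-*ʳ : ∀ (xs : List A) (f : A → ℕ) c → ∑ xs (λ x → f x * c) ≡ ∑ xs f * c
∑-*ʳ []       f c = refl
∑-*ʳ (x ∷ xs) f c =
  trans (cong (f x * c +_) (∑-*ʳ xs f c)) (sym (*-distribʳ-+ c (f x) (∑ xs f)))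

∑-swap : ∀ (xs : List A) (ys : List B) (h : A → B → ℕ) →
         ∑ xs (λ x → ∑ ys (h x)) ≡ ∑ ys (λ y → ∑ xs (λ x → h x y))
∑-swap []       ys h = sym (∑-zero ys (λ _ → refl))
∑-swap (x ∷ xs) ys h =
  trans (cong (∑ ys (h x) +_) (∑-swap xs ys h)) (sym (∑-+ ys (h x) _))

∑-cartesianProduct : ∀ (xs : List A) (ys : List B) (f : A × B → ℕ) →
                     ∑ (cartesianProduct xs ys) f ≡ ∑ xs (λ x → ∑ ys (λ y → f (x , y)))
∑-cartesianProduct []       ys f = refl
∑-cartesianProduct (x ∷ xs) ys f = begin
  sum (map f (map (x ,_) ys ++ cartesianProduct xs ys))
    ≡⟨ cong sum (map-++ f (map (x ,_) ys) _) ⟩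
  sum (map f (map (x ,_) ys) ++ map f (cartesianProduct xs ys))
    ≡⟨ sum-++ (map f (map (x ,_) ys)) _ ⟩
  sum (map f (map (x ,_) ys)) + ∑ (cartesianProduct xs ys) f
    ≡⟨ cong₂ _+_ (cong sum (sym (map-∘ ys))) (∑-cartesianProduct xs ys f) ⟩
  ∑ ys (λ y → f (x , y)) + ∑ xs (λ x → ∑ ys (λ y → f (x , y))) ∎
  where open ≡-Reasoning

∑-allFin-suc : ∀ n (f : Fin (suc n) → ℕ) → ∑ (allFin (suc n)) f ≡ f zero + ∑ (allFin n) (f ∘ suc)
∑-allFin-suc n f = cong (f zero +_)
  (trans (cong sum (map-tabulate suc f)) (sym (cong sum (map-tabulate (λ i → i) (f ∘ suc)))))

∑-allFin-const : ∀ n c → ∑ (allFin n) (const c) ≡ n * c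
∑-allFin-const zero    c = refl
∑-allFin-const (suc n) c = trans (∑-allFin-suc n (const c)) (cong (c +_) (∑-allFin-const n c))

∑-allFin-1+toℕ : ∀ n → ∑ (allFin n) (suc ∘ toℕ) ≡ n + ∑ (allFin n) toℕ
∑-allFin-1+toℕ n = trans (∑-+ (allFin n) (const 1) toℕ)
  (cong (_+ ∑ (allFin n) toℕ) (trans (∑-allFin-const n 1) (*-identityʳ n)))

∑-allFin-toℕ : ∀ n → 2 * ∑ (allFin n) toℕ + n ≡ n * n
∑-allFin-toℕ zero    = refl
∑-allFin-toℕ (suc n) = begin
  2 * ∑ (allFin (suc n)) toℕ + suc n
    ≡⟨ cong (λ t → 2 * t + suc n) (trans (∑-allFin-suc n toℕ) (∑-allFin-1+toℕ n)) ⟩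
  2 * (n + ∑ (allFin n) toℕ) + suc n
    ≡⟨ regroup n (∑ (allFin n) toℕ) ⟩
  (2 * ∑ (allFin n) toℕ + n) + (2 * n + 1)
    ≡⟨ cong (_+ (2 * n + 1)) (∑-allFin-toℕ n) ⟩
  n * n + (2 * n + 1)
    ≡⟨ solve (n ∷ []) ⟩
  suc n * suc n ∎
  where
  open ≡-Reasoning
  regroup : ∀ n t → 2 * (n + t) + suc n ≡ (2 * t + n) + (2 * n + 1)
  regroup n t = solve (n ∷ t ∷ [])
∑-allFin-affine : ∀ n w d → ∑ (allFin n) (λ k → w + toℕ k * d) ≡ n * w + ∑ (allFin n) toℕ * d
∑-allFin-affine n w d = trans (∑-+ (allFin n) (const w) (λ k → toℕ k * d))
  (cong₂ _+_ (∑-allFin-const n w) (∑-*ʳ (allFin n) toℕ d))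

[_]·_ : Dec P → ℕ → ℕ
[ yes _ ]· v = v
[ no _  ]· v = 0

[]·-yes : ∀ (P? : Dec P) {v} → P → [ P? ]· v ≡ v
[]·-yes (yes _) p = refl
[]·-yes (no ¬p) p = ⊥-elim (¬p p)

[]·-no : ∀ (P? : Dec P) {v} → ¬ P → [ P? ]· v ≡ 0
[]·-no (yes p) ¬p = ⊥-elim (¬p p)
[]·-no (no _)  ¬p = refl

[]·-⊎ : ∀ (P? : Dec P) (Q? : Dec Q) (R? : Dec R) {v} → P ⇔ (Q ⊎ R) → (Q → ¬ R) →
        [ P? ]· v ≡ [ Q? ]· v + [ R? ]· v
[]·-⊎ (yes _) (yes q) (yes r) _   q⇒¬r = ⊥-elim (q⇒¬r q r)
[]·-⊎ (yes _) (yes _) (no _)  _   _    = sym (+-identityʳ _)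
[]·-⊎ (yes _) (no _)  (yes _) _   _    = refl
[]·-⊎ (yes p) (no ¬q) (no ¬r) P⇔Q⊎R _ = ⊥-elim ([ ¬q , ¬r ] (Equivalence.to P⇔Q⊎R p))
[]·-⊎ (no ¬p) (yes q) _       P⇔Q⊎R _ = ⊥-elim (¬p (Equivalence.from P⇔Q⊎R (inj₁ q)))
[]·-⊎ (no ¬p) (no _)  (yes r) P⇔Q⊎R _ = ⊥-elim (¬p (Equivalence.from P⇔Q⊎R (inj₂ r)))
[]·-⊎ (no _)  (no _)  (no _)  _   _    = refl

∑-filter : ∀ {P : A → Set} (P? : Decidable P) (xs : List A) (f : A → ℕ) →
           ∑ (filter P? xs) f ≡ ∑ xs (λ x → [ P? x ]· f x)
∑-filter P? []       f = refl
∑-filter P? (x ∷ xs) f with P? x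
... | yes _ = cong (f x +_) (∑-filter P? xs f)
... | no _  = ∑-filter P? xs f

-- Every element occurs in xs exactly once, expressed through sums.
record IsEnumeration (xs : List A) : Set where
  constructor isEnumeration
  field
    ∑-single : ∀ a (f : A → ℕ) → (∀ x → x ≢ a → f x ≡ 0) → ∑ xs f ≡ f a

open IsEnumeration

allFin-isEnumeration : ∀ n → IsEnumeration (allFin n)
∑-single (allFin-isEnumeration (suc n)) zero f f≗0 = begin
  ∑ (allFin (suc n)) f            ≡⟨ ∑-allFin-suc n f ⟩
  f zero + ∑ (allFin n) (f ∘ suc) ≡⟨ cong (f zero +_) (∑-zero (allFin n) (λ i → f≗0 (suc i) λ ())) ⟩
  f zero + 0                      ≡⟨ +-identityʳ (f zero) ⟩
  f zero ∎
  where open ≡-Reasoning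
∑-single (allFin-isEnumeration (suc n)) (suc a) f f≗0 = begin
  ∑ (allFin (suc n)) f            ≡⟨ ∑-allFin-suc n f ⟩
  f zero + ∑ (allFin n) (f ∘ suc) ≡⟨ cong (_+ ∑ (allFin n) (f ∘ suc)) (f≗0 zero λ ()) ⟩
  ∑ (allFin n) (f ∘ suc)          ≡⟨ ∑-single (allFin-isEnumeration n) a (f ∘ suc)
                                       (λ i i≢a → f≗0 (suc i) (i≢a ∘ suc-injective)) ⟩
  f (suc a) ∎
  where open ≡-Reasoning

cartesianProduct-isEnumeration : ∀ {xs : List A} {ys : List B} →
  IsEnumeration xs → IsEnumeration ys → IsEnumeration (cartesianProduct xs ys)
∑-single (cartesianProduct-isEnumeration {xs = xs} {ys} enum₁ enum₂) (a , b) f f≗0 = begin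
  ∑ (cartesianProduct xs ys) f        ≡⟨ ∑-cartesianProduct xs ys f ⟩
  ∑ xs (λ x → ∑ ys (λ y → f (x , y))) ≡⟨ ∑-single enum₁ a _
                                           (λ x x≢a → ∑-zero ys (λ y → f≗0 (x , y) (x≢a ∘ cong proj₁))) ⟩
  ∑ ys (λ y → f (a , y))              ≡⟨ ∑-single enum₂ b _ (λ y y≢b → f≗0 (a , y) (y≢b ∘ cong proj₂)) ⟩
  f (a , b) ∎
  where open ≡-Reasoning

∑-point : ∀ {xs : List A} → IsEnumeration xs → (_≟_ : DecidableEquality A) →
          ∀ a (f : A → ℕ) → ∑ xs (λ x → [ x ≟ a ]· f x) ≡ f a
∑-point enum _≟_ a f =
  trans (∑-single enum a _ (λ x x≢a → []·-no (x ≟ a) x≢a)) ([]·-yes (a ≟ a) refl)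

∑-↔ : ∀ {xs : List A} {ys : List B} → IsEnumeration xs → IsEnumeration ys →
      DecidableEquality B → (φ : A ↔ B) (f : B → ℕ) → ∑ xs (f ∘ Inverse.to φ) ≡ ∑ ys f
∑-↔ {xs = xs} {ys} enum₁ enum₂ _≟_ φ f = begin
  ∑ xs (f ∘ to)                                  ≡⟨ ∑-cong xs (λ a → sym (∑-point enum₂ _≟_ (to a) f)) ⟩
  ∑ xs (λ a → ∑ ys (λ b → [ b ≟ to a ]· f b))    ≡⟨ ∑-swap xs ys _ ⟩
  ∑ ys (λ b → ∑ xs (λ a → [ b ≟ to a ]· f b))    ≡⟨ ∑-cong ys fibre ⟩
  ∑ ys f ∎
  where
  open ≡-Reasoning
  open Inverse φ
  fibre : ∀ b → ∑ xs (λ a → [ b ≟ to a ]· f b) ≡ f b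
  fibre b = trans
    (∑-single enum₁ (from b) _ (λ a a≢from-b → []·-no (b ≟ to a)
      (λ b≡to-a → a≢from-b (trans (sym (strictlyInverseʳ a)) (cong from (sym b≡to-a))))))
    ([]·-yes (b ≟ to (from b)) (sym (strictlyInverseˡ b)))

∑-filter-three : ∀ {P : A → Set} {xs : List A} → IsEnumeration xs → (_≟_ : DecidableEquality A) →
  (P? : Decidable P) {a b c : A} → a ≢ b → a ≢ c → b ≢ c →
  (∀ {y} → P y ⇔ (y ≡ a ⊎ y ≡ b ⊎ y ≡ c)) →
  ∀ f → ∑ (filter P? xs) f ≡ f a + (f b + f c)
∑-filter-three {A = A} {xs = xs} enum _≟_ P? {a} {b} {c} a≢b a≢c b≢c P⇔abc f = begin
  ∑ (filter P? xs) f                                       ≡⟨ ∑-filter P? xs f ⟩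
  ∑ xs (λ y → [ P? y ]· f y)                               ≡⟨ ∑-cong xs split ⟩
  ∑ xs (λ y → [ y ≟ a ]· f y + ([ y ≟ b ]· f y + [ y ≟ c ]· f y))
    ≡⟨ trans (∑-+ xs (δ a) _) (cong (∑ xs (δ a) +_) (∑-+ xs (δ b) (δ c))) ⟩
  ∑ xs (λ y → [ y ≟ a ]· f y) + (∑ xs (λ y → [ y ≟ b ]· f y) + ∑ xs (λ y → [ y ≟ c ]· f y))
    ≡⟨ cong₂ _+_ (∑-point enum _≟_ a f) (cong₂ _+_ (∑-point enum _≟_ b f) (∑-point enum _≟_ c f)) ⟩
  f a + (f b + f c) ∎
  where
  open ≡-Reasoning
  δ : A → A → ℕ
  δ p y = [ y ≟ p ]· f y
  split : ∀ y → [ P? y ]· f y ≡ [ y ≟ a ]· f y + ([ y ≟ b ]· f y + [ y ≟ c ]· f y)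
  split y = trans
    ([]·-⊎ (P? y) (y ≟ a) ((y ≟ b) ⊎-dec (y ≟ c)) P⇔abc
      (λ { refl (inj₁ a≡b) → a≢b a≡b ; refl (inj₂ a≡c) → a≢c a≡c }))
    (cong (_ +_) ([]·-⊎ ((y ≟ b) ⊎-dec (y ≟ c)) (y ≟ b) (y ≟ c) (⇔-id _) λ { refl → b≢c }))

[m+n%d]%d≡[m+n]%d : ∀ m n d .{{_ : NonZero d}} → (m + n % d) % d ≡ (m + n) % d
[m+n%d]%d≡[m+n]%d m n d = begin
  (m + n % d) % d           ≡⟨ %-distribˡ-+ m (n % d) d ⟩
  (m % d + n % d % d) % d   ≡⟨ cong (λ k → (m % d + k) % d) (m%n%n≡m%n n d) ⟩
  (m % d + n % d) % d       ≡⟨ %-distribˡ-+ m n d ⟨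
  (m + n) % d ∎
  where open ≡-Reasoning

[m%d+n]%d≡[m+n]%d : ∀ m n d .{{_ : NonZero d}} → (m % d + n) % d ≡ (m + n) % d
[m%d+n]%d≡[m+n]%d m n d = begin
  (m % d + n) % d ≡⟨ cong (_% d) (+-comm (m % d) n) ⟩
  (n + m % d) % d ≡⟨ [m+n%d]%d≡[m+n]%d n m d ⟩
  (n + m) % d     ≡⟨ cong (_% d) (+-comm n m) ⟩
  (m + n) % d ∎
  where open ≡-Reasoning

module _ {m : ℕ} where

  next prev : Fin (suc m) → Fin (suc m)
  next i = suc (toℕ i) mod suc m
  prev i = (toℕ i + m) mod suc m

  toℕ-next : ∀ i → toℕ (next i) ≡ suc (toℕ i) % suc m
  toℕ-next i = toℕ-fromℕ< _

  toℕ-prev : ∀ i → toℕ (prev i) ≡ (toℕ i + m) % suc m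
  toℕ-prev i = toℕ-fromℕ< _

  [i+n]%n≡i : ∀ (i : Fin (suc m)) → (toℕ i + suc m) % suc m ≡ toℕ i
  [i+n]%n≡i i = trans ([m+n]%n≡m%n (toℕ i) (suc m)) (m<n⇒m%n≡m (toℕ<n i))

  next-prev : ∀ i → next (prev i) ≡ i
  next-prev i = toℕ-injective (begin
    toℕ (next (prev i))          ≡⟨ toℕ-next (prev i) ⟩
    (1 + toℕ (prev i)) % suc m   ≡⟨ cong (λ k → (1 + k) % suc m) (toℕ-prev i) ⟩
    (1 + (toℕ i + m) % suc m) % suc m ≡⟨ [m+n%d]%d≡[m+n]%d 1 (toℕ i + m) (suc m) ⟩
    (1 + (toℕ i + m)) % suc m    ≡⟨ cong (_% suc m) (+-suc (toℕ i) m) ⟨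
    (toℕ i + suc m) % suc m      ≡⟨ [i+n]%n≡i i ⟩
    toℕ i ∎)
    where open ≡-Reasoning

  prev-next : ∀ i → prev (next i) ≡ i
  prev-next i = toℕ-injective (begin
    toℕ (prev (next i))                 ≡⟨ toℕ-prev (next i) ⟩
    (toℕ (next i) + m) % suc m          ≡⟨ cong (λ k → (k + m) % suc m) (toℕ-next i) ⟩
    (suc (toℕ i) % suc m + m) % suc m   ≡⟨ [m%d+n]%d≡[m+n]%d (suc (toℕ i)) m (suc m) ⟩
    (suc (toℕ i) + m) % suc m           ≡⟨ cong (_% suc m) (+-suc (toℕ i) m) ⟨
    (toℕ i + suc m) % suc m             ≡⟨ [i+n]%n≡i i ⟩
    toℕ i ∎)
    where open ≡-Reasoning

  rotation : Permutation′ (suc m)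
  rotation = permutation next prev next-prev prev-next

  -- Two steps forward return to i only if the cycle length divides 2.
  next²≢id : 2 ≤ m → ∀ i → next (next i) ≢ i
  next²≢id 2≤m i next²i≡i = ≤⇒≯ (∣⇒≤ (divides q 2≡q*n)) (s≤s 2≤m)
    where
    q = (2 + toℕ i) / suc m
    [2+i]%n≡i : (2 + toℕ i) % suc m ≡ toℕ i
    [2+i]%n≡i = begin
      (2 + toℕ i) % suc m                   ≡⟨ [m+n%d]%d≡[m+n]%d 1 (suc (toℕ i)) (suc m) ⟨
      (1 + suc (toℕ i) % suc m) % suc m     ≡⟨ cong (λ k → (1 + k) % suc m) (toℕ-next i) ⟨
      (1 + toℕ (next i)) % suc m            ≡⟨ toℕ-next (next i) ⟨
      toℕ (next (next i))                   ≡⟨ cong toℕ next²i≡i ⟩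
      toℕ i ∎
      where open ≡-Reasoning
    2≡q*n : 2 ≡ q * suc m
    2≡q*n = +-cancelˡ-≡ (toℕ i) 2 (q * suc m) (begin
      toℕ i + 2                       ≡⟨ +-comm (toℕ i) 2 ⟩
      2 + toℕ i                       ≡⟨ m≡m%n+[m/n]*n (2 + toℕ i) (suc m) ⟩
      (2 + toℕ i) % suc m + q * suc m ≡⟨ cong (_+ q * suc m) [2+i]%n≡i ⟩
      toℕ i + q * suc m ∎)
      where open ≡-Reasoning

  prev≢next : 2 ≤ m → ∀ i → prev i ≢ next i
  prev≢next 2≤m i prev≡next = next²≢id 2≤m i (trans (cong next (sym prev≡next)) (next-prev i))

  cycAdj⇔ : ∀ {i i'} → CycAdj (suc m) i i' ⇔ (i' ≡ prev i ⊎ i' ≡ next i)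
  cycAdj⇔ {i} {i'} = mk⇔ to from
    where
    to : CycAdj (suc m) i i' → i' ≡ prev i ⊎ i' ≡ next i
    to (inj₁ i'≡) = inj₂ (toℕ-injective (trans i'≡ (sym (toℕ-next i))))
    to (inj₂ i≡)  = inj₁ (trans (sym (prev-next i')) (cong prev (toℕ-injective (trans (toℕ-next i') (sym i≡)))))
    from : i' ≡ prev i ⊎ i' ≡ next i → CycAdj (suc m) i i'
    from (inj₁ refl) = inj₂ (trans (cong toℕ (sym (next-prev i))) (toℕ-next (prev i)))
    from (inj₂ refl) = inj₁ (toℕ-next i)

≢opposite : ∀ (j : Fin 2) → j ≢ opposite j
≢opposite zero       ()
≢opposite (suc zero) ()

≢⇒≡opposite : ∀ {j j' : Fin 2} → j ≢ j' → j' ≡ opposite j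
≢⇒≡opposite {zero}     {zero}     j≢j' = ⊥-elim (j≢j' refl)
≢⇒≡opposite {zero}     {suc zero} _    = refl
≢⇒≡opposite {suc zero} {zero}     _    = refl
≢⇒≡opposite {suc zero} {suc zero} j≢j' = ⊥-elim (j≢j' refl)

module _ {m : ℕ} where

  left right across : PrismV (suc m) → PrismV (suc m)
  left   (i , j) = prev i , j
  right  (i , j) = next i , j
  across (i , j) = i , opposite j

  prismAdj⇔ : ∀ {x y} → PrismAdj (suc m) x y ⇔ (y ≡ left x ⊎ y ≡ right x ⊎ y ≡ across x)
  prismAdj⇔ {i , j} {y} = mk⇔ to from
    where
    to : PrismAdj (suc m) (i , j) y → y ≡ (prev i , j) ⊎ y ≡ (next i , j) ⊎ y ≡ (i , opposite j)
    to (inj₁ (refl , i~i')) = Sum.map (cong (_, j)) (inj₁ ∘ cong (_, j)) (Equivalence.to cycAdj⇔ i~i')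
    to (inj₂ (refl , j≢j')) = inj₂ (inj₂ (cong (i ,_) (≢⇒≡opposite j≢j')))
    from : y ≡ (prev i , j) ⊎ y ≡ (next i , j) ⊎ y ≡ (i , opposite j) → PrismAdj (suc m) (i , j) y
    from (inj₁ refl)        = inj₁ (refl , Equivalence.from cycAdj⇔ (inj₁ refl))
    from (inj₂ (inj₁ refl)) = inj₁ (refl , Equivalence.from cycAdj⇔ (inj₂ refl))
    from (inj₂ (inj₂ refl)) = inj₂ (refl , ≢opposite j)

_≟ᵥ_ : ∀ {n} → DecidableEquality (PrismV n)
_≟ᵥ_ = ≡-dec _≟ᶠ_ _≟ᶠ_

prismVertices-isEnumeration : ∀ n → IsEnumeration (prismVertices n)
prismVertices-isEnumeration n =
  cartesianProduct-isEnumeration (allFin-isEnumeration n) (allFin-isEnumeration 2)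

∑-prism-↔ : ∀ {n} (φ : PrismV n ↔ PrismV n) (f : PrismV n → ℕ) →
            ∑ (prismVertices n) (f ∘ Inverse.to φ) ≡ ∑ (prismVertices n) f
∑-prism-↔ {n} = ∑-↔ (prismVertices-isEnumeration n) (prismVertices-isEnumeration n) _≟ᵥ_

∑-prism-⤖ : ∀ {n N} (g : PrismV n ⤖ Fin N) (F : Fin N → ℕ) →
            ∑ (prismVertices n) (F ∘ Bijection.to g) ≡ ∑ (allFin N) F
∑-prism-⤖ {n} {N} g =
  ∑-↔ (prismVertices-isEnumeration n) (allFin-isEnumeration N) _≟ᶠ_ (⤖⇒↔ g)

∑-label : ∀ {n} (f : PrismV n ⤖ Fin (2 * n)) →
          ∑ (prismVertices n) (label f) ≡ 2 * n + ∑ (allFin (2 * n)) toℕ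
∑-label {n} f = trans (∑-prism-⤖ f (suc ∘ toℕ)) (∑-allFin-1+toℕ (2 * n))

3[N+t]≡Nw+td⇒3+3N+d≡2w+dN : ∀ N t w d .{{_ : NonZero N}} → 2 * t + N ≡ N * N →
               3 * (N + t) ≡ N * w + t * d → 3 + 3 * N + d ≡ 2 * w + d * N
3[N+t]≡Nw+td⇒3+3N+d≡2w+dN N t w d 2t+N≡N² 3[N+t]≡Nw+td = *-cancelˡ-≡ _ _ N (begin
  N * (3 + 3 * N + d)             ≡⟨ solve (N ∷ d ∷ []) ⟩
  3 * N + 3 * (N * N) + d * N     ≡⟨ cong (λ s → 3 * N + 3 * s + d * N) 2t+N≡N² ⟨
  3 * N + 3 * (2 * t + N) + d * N ≡⟨ solve (N ∷ t ∷ d ∷ []) ⟩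
  2 * (3 * (N + t)) + d * N       ≡⟨ cong (λ s → 2 * s + d * N) 3[N+t]≡Nw+td ⟩
  2 * (N * w + t * d) + d * N     ≡⟨ solve (N ∷ t ∷ w ∷ d ∷ []) ⟩
  N * (2 * w) + d * (2 * t + N)   ≡⟨ cong (λ s → N * (2 * w) + d * s) 2t+N≡N² ⟩
  N * (2 * w) + d * (N * N)       ≡⟨ solve (N ∷ w ∷ d ∷ []) ⟩
  N * (2 * w + d * N) ∎)
  where open ≡-Reasoning

-- d is odd by parity, and d ≥ 3 would force w ≤ 3.
3+6K+d≡2w+2dK⇒d≡1 : ∀ K w d .{{_ : NonZero K}} → 4 ≤ w → 3 + 3 * (2 * K) + d ≡ 2 * w + d * (2 * K) → d ≡ 1
3+6K+d≡2w+2dK⇒d≡1 K w zero _ eq = ⊥-elim (even≢odd w (1 + 3 * K) (begin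
  2 * w                  ≡⟨ solve (w ∷ K ∷ []) ⟩
  2 * w + 0 * (2 * K)    ≡⟨ eq ⟨
  3 + 3 * (2 * K) + 0    ≡⟨ solve (K ∷ []) ⟩
  suc (2 * (1 + 3 * K)) ∎))
  where open ≡-Reasoning
3+6K+d≡2w+2dK⇒d≡1 K w 1 _ _ = refl
3+6K+d≡2w+2dK⇒d≡1 K w 2 _ eq = ⊥-elim (even≢odd (w + 2 * K) (2 + 3 * K) (begin
  2 * (w + 2 * K)        ≡⟨ solve (w ∷ K ∷ []) ⟩
  2 * w + 2 * (2 * K)    ≡⟨ eq ⟨
  3 + 3 * (2 * K) + 2    ≡⟨ solve (K ∷ []) ⟩
  suc (2 * (2 + 3 * K)) ∎))
  where open ≡-Reasoning
3+6K+d≡2w+2dK⇒d≡1 K w (suc (suc (suc e))) 4≤w eq = ⊥-elim (<-irrefl refl (begin-strict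
  3 + 3 * (2 * K) + (3 + e)   ≡⟨ solve (K ∷ e ∷ []) ⟩
  6 * K + e + 2 * 3           <⟨ +-monoʳ-< (6 * K + e) (*-monoʳ-< 2 4≤w) ⟩
  6 * K + e + 2 * w           ≤⟨ +-monoˡ-≤ (2 * w) (+-monoʳ-≤ (6 * K) (m≤m*n e (2 * K) {{m*n≢0 2 K}})) ⟩
  6 * K + e * (2 * K) + 2 * w ≡⟨ solve (K ∷ e ∷ w ∷ []) ⟩
  2 * w + (3 + e) * (2 * K)   ≡⟨ eq ⟨
  3 + 3 * (2 * K) + (3 + e) ∎))
  where open ≤-Reasoning

≢⇒0<+ : ∀ {a c} → a ≢ c → 0 < a + c
≢⇒0<+ {zero}  {zero}  a≢c = ⊥-elim (a≢c refl)
≢⇒0<+ {zero}  {suc c} _   = s≤s z≤n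
≢⇒0<+ {suc a}         _   = s≤s z≤n

4≤1+a+[1+b+1+c] : ∀ {a c} b → a ≢ c → 4 ≤ suc a + (suc b + suc c)
4≤1+a+[1+b+1+c] {a} {c} b a≢c = begin
  3 + 1                   ≤⟨ +-monoʳ-≤ 3 (≢⇒0<+ a≢c) ⟩
  3 + (a + c)             ≤⟨ +-monoʳ-≤ 3 (m≤m+n (a + c) b) ⟩
  3 + (a + c + b)         ≡⟨ solve (a ∷ b ∷ c ∷ []) ⟩
  suc a + (suc b + suc c) ∎
  where open ≤-Reasoning

ℤ-progression⇒ℕ-progression : ∀ {X : Set} (w r : X → ℕ) {a : ℤ} {d} x₀ → r x₀ ≡ 0 →
  (∀ x → ℤ.+ w x ≡ a ℤ.+ ℤ.+ (r x * d)) → ∀ x → w x ≡ w x₀ + r x * d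
ℤ-progression⇒ℕ-progression w r {a} {d} x₀ r₀≡0 w≡a+rd x = ℤ.+-injective (begin
  ℤ.+ w x                           ≡⟨ w≡a+rd x ⟩
  a ℤ.+ ℤ.+ (r x * d)               ≡⟨ cong (ℤ._+ ℤ.+ (r x * d)) a≡w₀ ⟩
  ℤ.+ w x₀ ℤ.+ ℤ.+ (r x * d) ∎)
  where
  open ≡-Reasoning
  a≡w₀ : a ≡ ℤ.+ w x₀
  a≡w₀ = sym (trans (w≡a+rd x₀) (trans (cong (λ k → a ℤ.+ ℤ.+ (k * d)) r₀≡0) (ℤ.+-identityʳ a)))

layers : ∀ {n} → PrismV n ↔ (Fin n ⊎ Fin n)
layers = mk↔ₛ′ to from to∘from from∘to
  where
  to : PrismV _ → Fin _ ⊎ Fin _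
  to (i , zero)     = inj₁ i
  to (i , suc zero) = inj₂ i
  from : Fin _ ⊎ Fin _ → PrismV _
  from (inj₁ i) = i , zero
  from (inj₂ i) = i , suc zero
  to∘from : ∀ k → to (from k) ≡ k
  to∘from (inj₁ _) = refl
  to∘from (inj₂ _) = refl
  from∘to : ∀ x → from (to x) ≡ x
  from∘to (_ , zero)     = refl
  from∘to (_ , suc zero) = refl

-- Vertex (i , 0) gets the index α i, vertex (i , 1) the index n + β i.
twoLayer : ∀ {n} → Permutation′ n → Permutation′ n → PrismV n ↔ Fin (2 * n)
twoLayer {n} α β = cast-id n+n≡2n ↔-∘ (↔-sym +↔⊎ ↔-∘ ((α ⊎-↔ β) ↔-∘ layers))
  where
  n+n≡2n : n + n ≡ 2 * n
  n+n≡2n = cong (n +_) (sym (+-identityʳ n))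

toℕ-twoLayer-bottom : ∀ {n} (α β : Permutation′ n) i →
                      toℕ (Inverse.to (twoLayer α β) (i , zero)) ≡ toℕ (α ⟨$⟩ʳ i)
toℕ-twoLayer-bottom {n} α β i = trans (toℕ-cast _ _) (toℕ-↑ˡ (α ⟨$⟩ʳ i) n)

toℕ-twoLayer-top : ∀ {n} (α β : Permutation′ n) i →
                   toℕ (Inverse.to (twoLayer α β) (i , suc zero)) ≡ n + toℕ (β ⟨$⟩ʳ i)
toℕ-twoLayer-top {n} α β i = trans (toℕ-cast _ _) (toℕ-↑ʳ n (β ⟨$⟩ʳ i))

toℕ+toℕ-opposite : ∀ {m} (k : Fin (suc m)) → toℕ k + toℕ (opposite k) ≡ m
toℕ+toℕ-opposite k = trans (cong (toℕ k +_) (opposite-prop k)) (m+[n∸m]≡n (toℕ≤pred[n] k))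

bottom-layer-sum : ∀ {m p o} q → p + o ≡ m → suc p + (suc q + suc (suc m + o)) ≡ 2 * suc m + 2 + q * 1
bottom-layer-sum {p = p} {o} q refl = solve (p ∷ q ∷ o ∷ [])

top-layer-sum : ∀ {m p o} q → p + o ≡ m → suc q + (suc (suc m + o) + suc p) ≡ 2 * suc m + 2 + q * 1
top-layer-sum {p = p} {o} q refl = solve (p ∷ q ∷ o ∷ [])

-- With labels f (i , 0) = 1 + i and f (i , 1) = 1 + n + (n - 1 - prev i), the weights are
-- w (i , 0) = 2n + 2 + next i and w (i , 1) = 2n + 2 + n + (n - 1 - prev (prev i)).
module _ {m : ℕ} where

  topLabels topRanks : Permutation′ (suc m)
  topLabels = flip rotation ∘ₚ reverse
  topRanks  = flip rotation ∘ₚ topLabels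

  antimagicLabeling antimagicRank : PrismV (suc m) ⤖ Fin (2 * suc m)
  antimagicLabeling = ↔⇒⤖ (twoLayer idₚ topLabels)
  antimagicRank     = ↔⇒⤖ (twoLayer rotation topRanks)

  label-bottom : ∀ i → label antimagicLabeling (i , zero) ≡ suc (toℕ i)
  label-bottom i = cong suc (toℕ-twoLayer-bottom idₚ topLabels i)

  label-top : ∀ i → label antimagicLabeling (i , suc zero) ≡ suc (suc m + toℕ (opposite (prev i)))
  label-top i = cong suc (toℕ-twoLayer-top idₚ topLabels i)

module _ {m : ℕ} (2≤m : 2 ≤ m) where

  weight≡ : ∀ f x → weight (suc m) f x ≡ label f (left x) + (label f (right x) + label f (across x))
  weight≡ f x@(i , j) =
    ∑-filter-three (prismVertices-isEnumeration (suc m)) _≟ᵥ_ (prismAdj? (suc m) x)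
      (prev≢next 2≤m i ∘ cong proj₁) (≢opposite j ∘ cong proj₂) (≢opposite j ∘ cong proj₂)
      prismAdj⇔ (label f)

  ∑-weight≡3∑label : ∀ f →
    ∑ (prismVertices (suc m)) (weight (suc m) f) ≡ 3 * ∑ (prismVertices (suc m)) (label f)
  ∑-weight≡3∑label f = begin
    ∑ V (weight (suc m) f)
      ≡⟨ ∑-cong V (weight≡ f) ⟩
    ∑ V (λ x → label f (left x) + (label f (right x) + label f (across x)))
      ≡⟨ trans (∑-+ V (label f ∘ left) _)
               (cong (∑ V (label f ∘ left) +_) (∑-+ V (label f ∘ right) (label f ∘ across))) ⟩
    ∑ V (label f ∘ left) + (∑ V (label f ∘ right) + ∑ V (label f ∘ across))
      ≡⟨ cong₂ _+_ (∑-prism-↔ (flip rotation ×-↔ idₚ) (label f))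
                   (cong₂ _+_ (∑-prism-↔ (rotation ×-↔ idₚ) (label f)) (∑-prism-↔ (idₚ ×-↔ reverse) (label f))) ⟩
    S + (S + S)
      ≡⟨ cong (λ s → S + (S + s)) (+-identityʳ S) ⟨
    3 * S ∎
    where
    open ≡-Reasoning
    V = prismVertices (suc m)
    S = ∑ V (label f)

  4≤weight : ∀ f x → 4 ≤ weight (suc m) f x
  4≤weight f x@(i , j) = subst (4 ≤_) (sym (weight≡ f x))
    (4≤1+a+[1+b+1+c] _ (≢opposite j ∘ cong proj₂ ∘ Bijection.injective f ∘ toℕ-injective))

  antimagic⇒d≡1 : ∀ {f a d} → IsDistanceAntimagic (suc m) f a d → d ≡ 1
  antimagic⇒d≡1 {f} {a} {d} (g , w≡a+rd) = 3+6K+d≡2w+2dK⇒d≡1 (suc m) w₀ d (4≤weight f x₀)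
    (3[N+t]≡Nw+td⇒3+3N+d≡2w+dN N (∑ (allFin N) toℕ) w₀ d (∑-allFin-toℕ N) (begin
      3 * (N + ∑ (allFin N) toℕ)               ≡⟨ cong (3 *_) (∑-label f) ⟨
      3 * ∑ V (label f)                        ≡⟨ ∑-weight≡3∑label f ⟨
      ∑ V (weight (suc m) f)                   ≡⟨ ∑-cong V w≡w₀+rd ⟩
      ∑ V (λ x → w₀ + rank x * d)             ≡⟨ ∑-prism-⤖ g (λ k → w₀ + toℕ k * d) ⟩
      ∑ (allFin N) (λ k → w₀ + toℕ k * d)     ≡⟨ ∑-allFin-affine N w₀ d ⟩
      N * w₀ + ∑ (allFin N) toℕ * d ∎))
    where
    open ≡-Reasoning
    N = 2 * suc m
    V = prismVertices (suc m)
    rank : PrismV (suc m) → ℕ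
    rank x = toℕ (Bijection.to g x)
    x₀ = Inverse.from (⤖⇒↔ g) zero
    w₀ = weight (suc m) f x₀
    w≡w₀+rd : ∀ x → weight (suc m) f x ≡ w₀ + rank x * d
    w≡w₀+rd = ℤ-progression⇒ℕ-progression (weight (suc m) f) rank {a} x₀
      (cong toℕ (Inverse.strictlyInverseˡ (⤖⇒↔ g) zero)) w≡a+rd

  weight-antimagicLabeling : ∀ x →
    weight (suc m) antimagicLabeling x ≡ 2 * suc m + 2 + toℕ (Bijection.to antimagicRank x) * 1
  weight-antimagicLabeling (i , zero) = begin
    weight (suc m) f (i , zero)
      ≡⟨ weight≡ f (i , zero) ⟩
    label f (prev i , zero) + (label f (next i , zero) + label f (i , suc zero))
      ≡⟨ cong₂ _+_ (label-bottom (prev i)) (cong₂ _+_ (label-bottom (next i)) (label-top i)) ⟩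
    suc (toℕ (prev i)) + (suc (toℕ (next i)) + suc (suc m + toℕ (opposite (prev i))))
      ≡⟨ bottom-layer-sum (toℕ (next i)) (toℕ+toℕ-opposite (prev i)) ⟩
    2 * suc m + 2 + toℕ (next i) * 1
      ≡⟨ cong (λ r → 2 * suc m + 2 + r * 1) (toℕ-twoLayer-bottom rotation topRanks i) ⟨
    2 * suc m + 2 + toℕ (Bijection.to antimagicRank (i , zero)) * 1 ∎
    where
    open ≡-Reasoning
    f = antimagicLabeling
  weight-antimagicLabeling (i , suc zero) = begin
    weight (suc m) f (i , suc zero)
      ≡⟨ weight≡ f (i , suc zero) ⟩
    label f (prev i , suc zero) + (label f (next i , suc zero) + label f (i , zero))
      ≡⟨ cong₂ _+_ (label-top (prev i)) (cong₂ _+_ (label-top (next i)) (label-bottom i)) ⟩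
    suc (suc m + o₂) + (suc (suc m + toℕ (opposite (prev (next i)))) + suc (toℕ i))
      ≡⟨ cong (λ k → suc (suc m + o₂) + (suc (suc m + toℕ (opposite k)) + suc (toℕ i))) (prev-next i) ⟩
    suc (suc m + o₂) + (suc (suc m + toℕ (opposite i)) + suc (toℕ i))
      ≡⟨ top-layer-sum (suc m + o₂) (toℕ+toℕ-opposite i) ⟩
    2 * suc m + 2 + (suc m + o₂) * 1
      ≡⟨ cong (λ r → 2 * suc m + 2 + r * 1) (toℕ-twoLayer-top rotation topRanks i) ⟨
    2 * suc m + 2 + toℕ (Bijection.to antimagicRank (i , suc zero)) * 1 ∎
    where
    open ≡-Reasoning
    f = antimagicLabeling
    o₂ = toℕ (opposite (prev (prev i)))

  antimagicLabeling-isDistanceAntimagic :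
    IsDistanceAntimagic (suc m) antimagicLabeling (ℤ.+ (2 * suc m + 2)) 1
  antimagicLabeling-isDistanceAntimagic = antimagicRank , cong ℤ.+_ ∘ weight-antimagicLabeling

mainTheorem8 : (n : ℕ) → 3 ≤ n → (d : ℕ) →
    (∃ λ (a : ℤ) → Σ (PrismV n ⤖ Fin (2 * n)) λ f → IsDistanceAntimagic n f a d)
    ⇔ (d ≡ 1)
mainTheorem8 (suc m) (s≤s 2≤m) d = mk⇔
  (λ (a , f , antimagic) → antimagic⇒d≡1 2≤m {f} {a} antimagic)
  (λ { refl → ℤ.+ _ , antimagicLabeling , antimagicLabeling-isDistanceAntimagic 2≤m })
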